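{- Let $a<b$ be positive integers such that the remainder $r$ of $b$ divided by $a$ is positive, let $R$ be a permutation of $[r]$ with complement $\overline{R}$, let $A$ be the extension sequence of $(R,a)$, and let $A'$ be the extension sequence of $(\overline{R},a)$. Let $B$ be the extension sequence of $(A',b)$. If $$\left\lceil\frac{rk}{a}\right\rceil = \sum_{i=a-r}^{a-1} \left\lfloor\frac{k+A(i)}{a}\right\rfloor \quad\text{for every nonnegative integer } k,$$ then $$\left\lceil\frac{ak}{b}\right\rceil = \sum_{i=b-a}^{b-1} \left\lfloor\frac{k+B(i)}{b}\right\rfloor \quad\text{for every nonnegative integer } k.$$
   Context: For a positive integer $m$, $[m]=\{0,1,\ldots,m-1\}$; a sequence of length $m$ has entries indexed by $[m]$, and $A(i)$ denotes its $i$-th entry. A permutation of $[m]$ is a sequence of length $m$ whose entries are $0,1,\ldots,m-1$ in some order. The complement of a permutation $R$ of $[m]$ is the permutation $\overline{R}$ of $[m]$ with $\overline{R}(i)=m-1-R(i)$. For positive integers $m<p$ and a permutation $P$ of $[m]$, the extension sequence of $(P,p)$ is the permutation $Q$ of $[p]$ such that for all $i,j\in[p]$, $Q(i)<Q(j)$ if and only if $P(i_0)<P(j_0)$, or $P(i_0)=P(j_0)$ and $i<j$, where $i_0,j_0$ are the remainders of $i,j$ upon division by $m$. -}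

module Defs where

open import Data.Nat using (ℕ; zero; suc; _+_; _*_; _∸_; _<_; _≤_; NonZero; _<?_)
open import Data.Nat.DivMod using (_/_; _%_)
open import Data.Fin using (Fin; toℕ; fromℕ<)
open import Data.Product using (_×_)
open import Data.Sum using (_⊎_)
open import Relation.Binary.PropositionalEquality using (_≡_)
open import Relation.Nullary using (yes; no)
open import Function.Definitions using (Bijective)
open import Function using (_⇔_)

IsPermutation : (m : ℕ) → (Fin m → Fin m) → Set
IsPermutation m P = Bijective _≡_ _≡_ P

complement : (m : ℕ) → (Fin m → Fin m) → (Fin m → ℕ)
complement m R i = m ∸ 1 ∸ toℕ (R i)

-- Entry of a sequence of length m at a natural index (0 outside [m]; never used there).
at : {m : ℕ} → (Fin m → ℕ) → ℕ → ℕ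
at {m} A i with i <? m
... | yes i<m = A (fromℕ< i<m)
... | no _ = 0

IsExtensionSeq : (m : ℕ) .{{_ : NonZero m}} → (P : Fin m → ℕ) → (p : ℕ) → (Q : Fin p → Fin p) → Set
IsExtensionSeq m P p Q =
  IsPermutation p Q ×
  (∀ (i j : Fin p) →
    (toℕ (Q i) < toℕ (Q j)) ⇔
      (at P (toℕ i % m) < at P (toℕ j % m)
        ⊎ (at P (toℕ i % m) ≡ at P (toℕ j % m) × toℕ i < toℕ j)))

sumFrom : ℕ → ℕ → (ℕ → ℕ) → ℕ
sumFrom lo zero f = 0
sumFrom lo (suc n) f = f lo + sumFrom (suc lo) n f

ceilDiv : ℕ → (d : ℕ) → .{{_ : NonZero d}} → ℕ
ceilDiv x d = (x + (d ∸ 1)) / d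

asℕ : {m : ℕ} → (Fin m → Fin m) → (Fin m → ℕ)
asℕ A i = toℕ (A i)

-- Write b = q a + r and let G t be the number of j < a with R (j mod r) > t.
-- Comparing ranks inside the extension sequences, the last r entries of A are
-- a - 1 - G (R (i mod r)), the first r entries of A' are G (R i), and the last a
-- entries of B are b - 1 - Y (A' (i mod a)), where Y w counts the j < b with
-- A' (j mod a) > w.  The hypothesis at k = w + 1 says that exactly ⌈r (w+1) / a⌉
-- values t < r have G t ≤ w; splitting [b] into q periods of A' and a tail of
-- length r this gives Y w = ⌊b (a-1-w) / a⌋.  For k = m b + s the summand belonging
-- to w is then m + [⌊b (a-1-w) / a⌋ < s] = m + [a - ⌈a s / b⌉ ≤ w], and summing
-- over w < a gives a m + ⌈a s / b⌉ = ⌈a k / b⌉.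

module Submission where

open import Defs
open import Data.Nat using (ℕ; _+_; _*_; _∸_; _<_; _/_; _%_; NonZero; nonZero)
open import Data.Fin using (Fin)
open import Relation.Binary.PropositionalEquality using (_≡_)

open import Data.Nat using (zero; suc; _≤_; s≤s⁻¹; z<s)
open import Data.Nat.Properties
open import Data.Nat.DivMod
open import Data.Nat.Divisibility using (n∣m*n)
open import Data.Fin using (toℕ; fromℕ<)
open import Data.Fin.Properties using (toℕ<n; toℕ-fromℕ<; fromℕ<-toℕ; toℕ-injective)
open import Data.Fin.Permutation using (Permutation)
open import Data.Product using (_,_; proj₁; proj₂)
open import Data.Sum using (inj₁; inj₂)
open import Function using (_∘_; _⇔_; mk⇔; Equivalence)
open import Function.Definitions using (Injective)
open import Function.Bundles using (mk↔ₛ′)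
open import Relation.Nullary using (Dec; yes; no; ¬_; contradiction)
open import Relation.Binary.PropositionalEquality
  using (refl; sym; trans; cong; cong₂; subst; subst₂; _≢_; module ≡-Reasoning)
open import Algebra.Properties.CommutativeSemigroup +-commutativeSemigroup
  using (interchange; xy∙z≈xz∙y; x∙yz≈zx∙y)
open import Algebra.Properties.CommutativeMonoid.Sum +-0-commutativeMonoid
  using (sum; sum-permute; sum-cong-≗)

-- Finite sums and counting

𝟙 : ∀ {p} {P : Set p} → Dec P → ℕ
𝟙 (yes _) = 1
𝟙 (no _)  = 0

𝟙-yes : ∀ {p} {P : Set p} (P? : Dec P) → P → 𝟙 P? ≡ 1
𝟙-yes (yes _) _  = refl
𝟙-yes (no ¬p) p  = contradiction p ¬p

𝟙-no : ∀ {p} {P : Set p} (P? : Dec P) → ¬ P → 𝟙 P? ≡ 0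
𝟙-no (yes p) ¬p = contradiction p ¬p
𝟙-no (no _)  _  = refl

𝟙-cong : ∀ {p q} {P : Set p} {Q : Set q} (P? : Dec P) (Q? : Dec Q) → P ⇔ Q → 𝟙 P? ≡ 𝟙 Q?
𝟙-cong P? (yes q) P⇔Q = 𝟙-yes P? (Equivalence.from P⇔Q q)
𝟙-cong P? (no ¬q) P⇔Q = 𝟙-no P? (¬q ∘ Equivalence.to P⇔Q)

𝟙-≤+< : ∀ x y → 𝟙 (x ≤? y) + 𝟙 (y <? x) ≡ 1
𝟙-≤+< x y with x ≤? y
... | yes x≤y = cong (1 +_) (𝟙-no (y <? x) (≤⇒≯ x≤y))
... | no x≰y  = 𝟙-yes (y <? x) (≰⇒> x≰y)


∑< : ℕ → (ℕ → ℕ) → ℕ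
∑< zero    f = 0
∑< (suc n) f = ∑< n f + f n

∑<-cong : ∀ n {f g : ℕ → ℕ} → (∀ {i} → i < n → f i ≡ g i) → ∑< n f ≡ ∑< n g
∑<-cong zero    f≗g = refl
∑<-cong (suc n) f≗g = cong₂ _+_ (∑<-cong n (f≗g ∘ m<n⇒m<1+n)) (f≗g (n<1+n n))

∑<-cong-Fin : ∀ n {f g : ℕ → ℕ} → (∀ (j : Fin n) → f (toℕ j) ≡ g (toℕ j)) → ∑< n f ≡ ∑< n g
∑<-cong-Fin n {f} {g} f≗g = ∑<-cong n λ i<n →
  subst (λ i → f i ≡ g i) (toℕ-fromℕ< i<n) (f≗g (fromℕ< i<n))

∑<-distrib-+ : ∀ n (f g : ℕ → ℕ) → ∑< n (λ i → f i + g i) ≡ ∑< n f + ∑< n g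
∑<-distrib-+ zero    f g = refl
∑<-distrib-+ (suc n) f g =
  trans (cong (_+ (f n + g n)) (∑<-distrib-+ n f g)) (interchange (∑< n f) (∑< n g) (f n) (g n))

∑<-const : ∀ n c → ∑< n (λ _ → c) ≡ n * c
∑<-const zero    c = refl
∑<-const (suc n) c = trans (cong (_+ c) (∑<-const n c)) (+-comm (n * c) c)

∑<-++ : ∀ m n (f : ℕ → ℕ) → ∑< (m + n) f ≡ ∑< m f + ∑< n (λ i → f (m + i))
∑<-++ m zero    f rewrite +-identityʳ m = sym (+-identityʳ (∑< m f))
∑<-++ m (suc n) f rewrite +-suc m n | ∑<-++ m n f = +-assoc (∑< m f) _ _

sumFrom≡∑< : ∀ lo n (f : ℕ → ℕ) → sumFrom lo n f ≡ ∑< n (λ i → f (lo + i))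
sumFrom≡∑< lo zero    f = refl
sumFrom≡∑< lo (suc n) f = begin
  f lo + sumFrom (suc lo) n f              ≡⟨ cong₂ _+_ (cong f (sym (+-identityʳ lo))) (sumFrom≡∑< (suc lo) n f) ⟩
  f (lo + 0) + ∑< n (λ i → f (suc lo + i))  ≡⟨ cong (f (lo + 0) +_) (∑<-cong n λ {i} _ → cong f (sym (+-suc lo i))) ⟩
  f (lo + 0) + ∑< n (λ i → f (lo + suc i))  ≡⟨ ∑<-++ 1 n (λ i → f (lo + i)) ⟨
  ∑< (suc n) (λ i → f (lo + i))             ∎
  where open ≡-Reasoning

∑<-rotate : ∀ n .{{_ : NonZero n}} (g : ℕ → ℕ) c → ∑< n (λ i → g ((c + i) % n)) ≡ ∑< n g
∑<-rotate n       g zero    = ∑<-cong n (cong g ∘ m<n⇒m%n≡m)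
∑<-rotate (suc n) g (suc c) = begin
  ∑< n (λ i → g ((suc c + i) % suc n)) + g ((suc c + n) % suc n) ≡⟨ cong (λ t → ∑< n (λ i → g ((suc c + i) % suc n)) + g t) wrap ⟩
  ∑< n (λ i → g ((suc c + i) % suc n)) + g ((c + 0) % suc n)     ≡⟨ +-comm _ (g ((c + 0) % suc n)) ⟩
  g ((c + 0) % suc n) + ∑< n (λ i → g ((suc c + i) % suc n))     ≡⟨ cong (g ((c + 0) % suc n) +_) (∑<-cong n λ {i} _ →
                                                                        cong (λ t → g (t % suc n)) (sym (+-suc c i))) ⟩
  g ((c + 0) % suc n) + ∑< n (λ i → g ((c + suc i) % suc n))     ≡⟨ ∑<-++ 1 n (λ i → g ((c + i) % suc n)) ⟨
  ∑< (suc n) (λ i → g ((c + i) % suc n))                         ≡⟨ ∑<-rotate (suc n) g c ⟩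
  ∑< (suc n) g                                                   ∎
  where
  open ≡-Reasoning
  wrap : (suc c + n) % suc n ≡ (c + 0) % suc n
  wrap = begin
    (suc c + n) % suc n ≡⟨ cong (_% suc n) (sym (+-suc c n)) ⟩
    (c + suc n) % suc n ≡⟨ [m+n]%n≡m%n c (suc n) ⟩
    c % suc n           ≡⟨ cong (_% suc n) (sym (+-identityʳ c)) ⟩
    (c + 0) % suc n     ∎

∑<-periodic : ∀ q n .{{_ : NonZero n}} (g : ℕ → ℕ) → ∑< (q * n) (λ i → g (i % n)) ≡ q * ∑< n g
∑<-periodic zero    n g = refl
∑<-periodic (suc q) n g = begin
  ∑< (n + q * n) (λ i → g (i % n))                              ≡⟨ ∑<-++ n (q * n) _ ⟩
  ∑< n (λ i → g (i % n)) + ∑< (q * n) (λ i → g ((n + i) % n))   ≡⟨ cong₂ _+_ (∑<-cong n (cong g ∘ m<n⇒m%n≡m))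
                                                                             (∑<-cong (q * n) λ {i} _ → cong g (period i)) ⟩
  ∑< n g + ∑< (q * n) (λ i → g (i % n))                         ≡⟨ cong (∑< n g +_) (∑<-periodic q n g) ⟩
  ∑< n g + q * ∑< n g                                           ∎
  where
  open ≡-Reasoning
  period : ∀ i → (n + i) % n ≡ i % n
  period i = trans (cong (_% n) (+-comm n i)) ([m+n]%n≡m%n i n)

∑<≡sum : ∀ n (f : ℕ → ℕ) → ∑< n f ≡ sum {n} (λ i → f (toℕ i))
∑<≡sum zero    f = refl
∑<≡sum (suc n) f = trans (∑<-++ 1 n f) (cong (f 0 +_) (∑<≡sum n (f ∘ suc)))

count-≤+< : ∀ n (f : ℕ → ℕ) t → ∑< n (λ i → 𝟙 (t ≤? f i)) + ∑< n (λ i → 𝟙 (f i <? t)) ≡ n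
count-≤+< n f t = begin
  ∑< n (λ i → 𝟙 (t ≤? f i)) + ∑< n (λ i → 𝟙 (f i <? t)) ≡⟨ ∑<-distrib-+ n _ _ ⟨
  ∑< n (λ i → 𝟙 (t ≤? f i) + 𝟙 (f i <? t))              ≡⟨ ∑<-cong n (λ {i} _ → 𝟙-≤+< t (f i)) ⟩
  ∑< n (λ _ → 1)                                         ≡⟨ ∑<-const n 1 ⟩
  n * 1                                                  ≡⟨ *-identityʳ n ⟩
  n                                                      ∎
  where open ≡-Reasoning

count-< : ∀ {n t} → t ≤ n → ∑< n (λ y → 𝟙 (y <? t)) ≡ t
count-< {n} {t} t≤n = begin
  ∑< n (λ y → 𝟙 (y <? t))                                        ≡⟨ cong (λ k → ∑< k _) (m+[n∸m]≡n t≤n) ⟨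
  ∑< (t + (n ∸ t)) (λ y → 𝟙 (y <? t))                            ≡⟨ ∑<-++ t (n ∸ t) _ ⟩
  ∑< t (λ y → 𝟙 (y <? t)) + ∑< (n ∸ t) (λ i → 𝟙 (t + i <? t))    ≡⟨ cong₂ _+_
                                                                     (∑<-cong t λ y<t → 𝟙-yes (_ <? t) y<t)
                                                                     (∑<-cong (n ∸ t) λ {i} _ → 𝟙-no (_ <? t) (m+n≮m t i)) ⟩
  ∑< t (λ _ → 1) + ∑< (n ∸ t) (λ _ → 0)                          ≡⟨ cong₂ _+_ (∑<-const t 1) (∑<-const (n ∸ t) 0) ⟩
  t * 1 + (n ∸ t) * 0                                            ≡⟨ cong₂ _+_ (*-identityʳ t) (*-zeroʳ (n ∸ t)) ⟩
  t + 0                                                          ≡⟨ +-identityʳ t ⟩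
  t                                                              ∎
  where open ≡-Reasoning

count-≥ : ∀ {n t} → t ≤ n → ∑< n (λ y → 𝟙 (t ≤? y)) ≡ n ∸ t
count-≥ {n} {t} t≤n = begin
  ∑< n (λ y → 𝟙 (t ≤? y))                                   ≡⟨ m+n∸n≡m _ t ⟨
  ∑< n (λ y → 𝟙 (t ≤? y)) + t ∸ t                           ≡⟨ cong (λ c → ∑< n (λ y → 𝟙 (t ≤? y)) + c ∸ t) (count-< t≤n) ⟨
  ∑< n (λ y → 𝟙 (t ≤? y)) + ∑< n (λ y → 𝟙 (y <? t)) ∸ t     ≡⟨ cong (_∸ t) (count-≤+< n (λ y → y) t) ⟩
  n ∸ t                                                      ∎
  where open ≡-Reasoning

count-threshold : ∀ {a c} → c ≤ a → ∑< a (λ w → 𝟙 (a ∸ c ≤? w)) ≡ c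
count-threshold {a} {c} c≤a = trans (count-≥ (m∸n≤m a c)) (m∸[m∸n]≡n c≤a)

at-fromℕ< : ∀ {m} (P : Fin m → ℕ) {i} (i<m : i < m) → at P i ≡ P (fromℕ< i<m)
at-fromℕ< {m} P {i} i<m with i <? m
... | yes _   = refl
... | no i≮m = contradiction i<m i≮m

at-toℕ : ∀ {m} (P : Fin m → ℕ) (i : Fin m) → at P (toℕ i) ≡ P i
at-toℕ P i = trans (at-fromℕ< P (toℕ<n i)) (cong P (fromℕ<-toℕ i (toℕ<n i)))

at-asℕ< : ∀ {m} (Q : Fin m → Fin m) {i} → i < m → at (asℕ Q) i < m
at-asℕ< Q i<m = subst (_< _) (sym (at-fromℕ< (asℕ Q) i<m)) (toℕ<n (Q (fromℕ< i<m)))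

at-injective : ∀ {m} {P : Fin m → ℕ} → Injective _≡_ _≡_ P →
               ∀ {x y} → x < m → y < m → at P x ≡ at P y → x ≡ y
at-injective {P = P} P-inj {x} {y} x<m y<m Px≡Py = begin
  x                ≡⟨ toℕ-fromℕ< x<m ⟨
  toℕ (fromℕ< x<m) ≡⟨ cong toℕ (P-inj (trans (sym (at-fromℕ< P x<m)) (trans Px≡Py (at-fromℕ< P y<m)))) ⟩
  toℕ (fromℕ< y<m) ≡⟨ toℕ-fromℕ< y<m ⟩
  y                ∎
  where open ≡-Reasoning

asℕ-injective : ∀ {m} {Q : Fin m → Fin m} → IsPermutation m Q → Injective _≡_ _≡_ (asℕ Q)
asℕ-injective Q-perm = proj₁ Q-perm ∘ toℕ-injective

module _ {p : ℕ} {Q : Fin p → Fin p} (Q-perm : IsPermutation p Q) where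

  ∑<-permute : (h : ℕ → ℕ) → ∑< p (λ i → h (at (asℕ Q) i)) ≡ ∑< p h
  ∑<-permute h = begin
    ∑< p (λ i → h (at (asℕ Q) i))          ≡⟨ ∑<≡sum p _ ⟩
    sum {p} (λ i → h (at (asℕ Q) (toℕ i))) ≡⟨ sum-cong-≗ {p} (cong h ∘ at-toℕ (asℕ Q)) ⟩
    sum {p} (λ i → h (toℕ (Q i)))          ≡⟨ sum-permute (h ∘ toℕ) π ⟨
    sum {p} (λ i → h (toℕ i))              ≡⟨ ∑<≡sum p h ⟨
    ∑< p h                                 ∎
    where
    open ≡-Reasoning
    Q⁻¹ : Fin p → Fin p
    Q⁻¹ y = proj₁ (proj₂ Q-perm y)
    Q∘Q⁻¹ : ∀ y → Q (Q⁻¹ y) ≡ y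
    Q∘Q⁻¹ y = proj₂ (proj₂ Q-perm y) refl
    π : Permutation p p
    π = mk↔ₛ′ Q Q⁻¹ Q∘Q⁻¹ (λ x → proj₁ Q-perm (Q∘Q⁻¹ (Q x)))

  ∑<-rotate-permute : .{{_ : NonZero p}} (h : ℕ → ℕ) (c : ℕ) → ∑< p (λ i → h (at (asℕ Q) ((c + i) % p))) ≡ ∑< p h
  ∑<-rotate-permute h c = trans (∑<-rotate p (h ∘ at (asℕ Q)) c) (∑<-permute h)

  count<-permute : ∀ {t} → t ≤ p → ∑< p (λ j → 𝟙 (at (asℕ Q) j <? t)) ≡ t
  count<-permute t≤p = trans (∑<-permute (λ y → 𝟙 (y <? _))) (count-< t≤p)

  count≥-permute : ∀ {t} → t ≤ p → ∑< p (λ j → 𝟙 (t ≤? at (asℕ Q) j)) ≡ p ∸ t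
  count≥-permute t≤p = trans (∑<-permute (λ y → 𝟙 (_ ≤? y))) (count-≥ t≤p)

module _ {r : ℕ} {R : Fin r → Fin r} where

  toℕ≤r∸1 : ∀ i → toℕ (R i) ≤ r ∸ 1
  toℕ≤r∸1 i = ∸-monoˡ-≤ 1 (toℕ<n (R i))

  complement-injective : IsPermutation r R → Injective _≡_ _≡_ (complement r R)
  complement-injective R-perm {i} {j} = asℕ-injective R-perm ∘ ∸-cancelˡ-≡ (toℕ≤r∸1 i) (toℕ≤r∸1 j)

  at-complement-<⇔ : ∀ {x y} → x < r → y < r →
                     at (complement r R) x < at (complement r R) y ⇔ at (asℕ R) y < at (asℕ R) x
  at-complement-<⇔ x<r y<r
    rewrite at-fromℕ< (complement r R) x<r | at-fromℕ< (complement r R) y<r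
          | at-fromℕ< (asℕ R) x<r | at-fromℕ< (asℕ R) y<r
    = mk⇔ (λ lt → ≰⇒> (<⇒≱ lt ∘ ∸-monoʳ-≤ (r ∸ 1))) (λ lt → ∸-monoʳ-< lt (toℕ≤r∸1 _))

-- Extension sequences

m<n<m+d⇒n%d≢m%d : ∀ {m n} d .{{_ : NonZero d}} → m < n → n < m + d → n % d ≢ m % d
m<n<m+d⇒n%d≢m%d {m} {n} d m<n n<m+d n%d≡m%d with n / d ≤? m / d
... | yes n/d≤m/d = <⇒≱ m<n (begin
  n                     ≡⟨ m≡m%n+[m/n]*n n d ⟩
  n % d + (n / d) * d   ≤⟨ +-mono-≤ (≤-reflexive n%d≡m%d) (*-monoˡ-≤ d n/d≤m/d) ⟩
  m % d + (m / d) * d   ≡⟨ m≡m%n+[m/n]*n m d ⟨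
  m                     ∎)
  where open ≤-Reasoning
... | no n/d≰m/d = <⇒≱ n<m+d (begin
  m + d                        ≡⟨ cong (_+ d) (m≡m%n+[m/n]*n m d) ⟩
  m % d + (m / d) * d + d      ≡⟨ +-assoc (m % d) _ d ⟩
  m % d + ((m / d) * d + d)    ≡⟨ cong (m % d +_) (+-comm _ d) ⟩
  m % d + suc (m / d) * d      ≤⟨ +-mono-≤ (≤-reflexive (sym n%d≡m%d)) (*-monoˡ-≤ d (≰⇒> n/d≰m/d)) ⟩
  n % d + (n / d) * d          ≡⟨ m≡m%n+[m/n]*n n d ⟨
  n                            ∎)
  where open ≤-Reasoning

module _ {m : ℕ} .{{_ : NonZero m}} {P : Fin m → ℕ} (P-inj : Injective _≡_ _≡_ P)
         {p : ℕ} {Q : Fin p → Fin p} (Q-ext : IsExtensionSeq m P p Q) where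

  ext-<⇔ : (i j : Fin p) → (toℕ i < toℕ j → toℕ j % m ≢ toℕ i % m) →
           toℕ (Q i) < toℕ (Q j) ⇔ at P (toℕ i % m) < at P (toℕ j % m)
  ext-<⇔ i j no-tie = mk⇔ to (λ lt → Equivalence.from (proj₂ Q-ext i j) (inj₁ lt))
    where
    to : toℕ (Q i) < toℕ (Q j) → at P (toℕ i % m) < at P (toℕ j % m)
    to Qi<Qj with Equivalence.to (proj₂ Q-ext i j) Qi<Qj
    ... | inj₁ lt         = lt
    ... | inj₂ (eq , i<j) =
      contradiction (sym (at-injective P-inj (m%n<n (toℕ i) m) (m%n<n (toℕ j) m) eq)) (no-tie i<j)

  ext-rank-first : ∀ {i} (i<p : i < p) → i < m →
                   at (asℕ Q) i ≡ ∑< p (λ j → 𝟙 (at P (j % m) <? at P i))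
  ext-rank-first {i} i<p i<m = begin
    at (asℕ Q) i                                 ≡⟨ at-fromℕ< (asℕ Q) i<p ⟩
    toℕ (Q I)                                    ≡⟨ count<-permute (proj₁ Q-ext) (<⇒≤ (toℕ<n (Q I))) ⟨
    ∑< p (λ j → 𝟙 (at (asℕ Q) j <? toℕ (Q I)))   ≡⟨ ∑<-cong-Fin p ranks ⟩
    ∑< p (λ j → 𝟙 (at P (j % m) <? at P i))      ∎
    where
    open ≡-Reasoning
    I = fromℕ< i<p
    I%m≡i : toℕ I % m ≡ i
    I%m≡i = trans (cong (_% m) (toℕ-fromℕ< i<p)) (m<n⇒m%n≡m i<m)
    no-tie : (J : Fin p) → toℕ J < toℕ I → toℕ I % m ≢ toℕ J % m
    no-tie J J<I I≡J = <⇒≢ J<I (begin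
      toℕ J      ≡⟨ m<n⇒m%n≡m (<-trans J<I (subst (_< m) (sym (toℕ-fromℕ< i<p)) i<m)) ⟨
      toℕ J % m  ≡⟨ I≡J ⟨
      toℕ I % m  ≡⟨ I%m≡i ⟩
      i          ≡⟨ toℕ-fromℕ< i<p ⟨
      toℕ I      ∎)
    ranks : (J : Fin p) → 𝟙 (at (asℕ Q) (toℕ J) <? toℕ (Q I)) ≡ 𝟙 (at P (toℕ J % m) <? at P i)
    ranks J = begin
      𝟙 (at (asℕ Q) (toℕ J) <? toℕ (Q I))        ≡⟨ cong (λ x → 𝟙 (x <? toℕ (Q I))) (at-toℕ (asℕ Q) J) ⟩
      𝟙 (toℕ (Q J) <? toℕ (Q I))                 ≡⟨ 𝟙-cong _ _ (ext-<⇔ J I (no-tie J)) ⟩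
      𝟙 (at P (toℕ J % m) <? at P (toℕ I % m))   ≡⟨ cong (λ t → 𝟙 (at P (toℕ J % m) <? at P t)) I%m≡i ⟩
      𝟙 (at P (toℕ J % m) <? at P i)             ∎

  ext-rank-last : ∀ {i} (i<p : i < p) → p ≤ i + m →
                  at (asℕ Q) i + suc (∑< p (λ j → 𝟙 (at P (i % m) <? at P (j % m)))) ≡ p
  ext-rank-last {i} i<p p≤i+m = begin
    at (asℕ Q) i + suc (∑< p (λ j → 𝟙 (at P (i % m) <? at P (j % m))))
      ≡⟨ cong₂ (λ x y → x + suc y) (at-fromℕ< (asℕ Q) i<p) (∑<-cong-Fin p ranks) ⟩
    toℕ (Q I) + suc (∑< p (λ j → 𝟙 (toℕ (Q I) <? at (asℕ Q) j)))
      ≡⟨ +-suc (toℕ (Q I)) _ ⟩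
    suc (toℕ (Q I)) + ∑< p (λ j → 𝟙 (suc (toℕ (Q I)) ≤? at (asℕ Q) j))
      ≡⟨ cong (suc (toℕ (Q I)) +_) (count≥-permute (proj₁ Q-ext) (toℕ<n (Q I))) ⟩
    suc (toℕ (Q I)) + (p ∸ suc (toℕ (Q I)))
      ≡⟨ m+[n∸m]≡n (toℕ<n (Q I)) ⟩
    p ∎
    where
    open ≡-Reasoning
    I = fromℕ< i<p
    I≡i : toℕ I ≡ i
    I≡i = toℕ-fromℕ< i<p
    no-tie : (J : Fin p) → toℕ I < toℕ J → toℕ J % m ≢ toℕ I % m
    no-tie J I<J = m<n<m+d⇒n%d≢m%d m I<J (<-≤-trans (toℕ<n J) (subst (λ t → p ≤ t + m) (sym I≡i) p≤i+m))
    ranks : (J : Fin p) → 𝟙 (at P (i % m) <? at P (toℕ J % m)) ≡ 𝟙 (toℕ (Q I) <? at (asℕ Q) (toℕ J))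
    ranks J = begin
      𝟙 (at P (i % m) <? at P (toℕ J % m))       ≡⟨ cong (λ t → 𝟙 (at P (t % m) <? at P (toℕ J % m))) I≡i ⟨
      𝟙 (at P (toℕ I % m) <? at P (toℕ J % m))   ≡⟨ 𝟙-cong _ _ (ext-<⇔ I J (no-tie J)) ⟨
      𝟙 (toℕ (Q I) <? toℕ (Q J))                 ≡⟨ cong (λ x → 𝟙 (toℕ (Q I) <? x)) (at-toℕ (asℕ Q) J) ⟨
      𝟙 (toℕ (Q I) <? at (asℕ Q) (toℕ J))        ∎

-- Floors and ceilings

[m+kn]/n≡m/n+k : ∀ m k n .{{_ : NonZero n}} → (m + k * n) / n ≡ m / n + k
[m+kn]/n≡m/n+k m k n = trans (+-distrib-/-∣ʳ m (n∣m*n k)) (cong (m / n +_) (m*n/n≡m k n))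

[m+n]/d≡[m%d+n]/d+m/d : ∀ m n d .{{_ : NonZero d}} → (m + n) / d ≡ (m % d + n) / d + m / d
[m+n]/d≡[m%d+n]/d+m/d m n d = begin
  (m + n) / d                       ≡⟨ cong (λ x → (x + n) / d) (m≡m%n+[m/n]*n m d) ⟩
  (m % d + m / d * d + n) / d       ≡⟨ cong (_/ d) (xy∙z≈xz∙y (m % d) (m / d * d) n) ⟩
  (m % d + n + m / d * d) / d       ≡⟨ [m+kn]/n≡m/n+k (m % d + n) (m / d) d ⟩
  (m % d + n) / d + m / d           ∎
  where open ≡-Reasoning

/-<⇔ : ∀ x s d .{{_ : NonZero d}} → x / d < s ⇔ x < s * d
/-<⇔ x s d = mk⇔ (λ x/d<s → ≰⇒> λ sd≤x → <⇒≱ x/d<s (subst (_≤ x / d) (m*n/n≡m s d) (/-monoˡ-≤ d sd≤x)))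
                 m<n*o⇒m/o<n

/-unique : ∀ {x q} d .{{_ : NonZero d}} → q * d ≤ x → x < suc q * d → x / d ≡ q
/-unique {x} {q} d qd≤x x<[1+q]d =
  ≤-antisym (s≤s⁻¹ (m<n*o⇒m/o<n x<[1+q]d)) (subst (_≤ x / d) (m*n/n≡m q d) (/-monoˡ-≤ d qd≤x))

ceilDiv-+* : ∀ x k d .{{_ : NonZero d}} → ceilDiv (x + k * d) d ≡ ceilDiv x d + k
ceilDiv-+* x k d = trans (cong (_/ d) (xy∙z≈xz∙y x (k * d) (d ∸ 1))) ([m+kn]/n≡m/n+k (x + (d ∸ 1)) k d)

ceilDiv-*≥ : ∀ x d .{{_ : NonZero d}} → x ≤ ceilDiv x d * d
ceilDiv-*≥ x (suc d) = +-cancelʳ-≤ d x (ceilDiv x (suc d) * suc d) (begin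
  x + d                                          ≡⟨ m≡m%n+[m/n]*n (x + d) (suc d) ⟩
  (x + d) % suc d + (x + d) / suc d * suc d      ≤⟨ +-monoˡ-≤ _ (s≤s⁻¹ (m%n<n (x + d) (suc d))) ⟩
  d + (x + d) / suc d * suc d                    ≡⟨ +-comm d _ ⟩
  ceilDiv x (suc d) * suc d + d                  ∎)
  where open ≤-Reasoning

ceilDiv-*< : ∀ x d .{{_ : NonZero d}} → ceilDiv x d * d < x + d
ceilDiv-*< x (suc d) = ≤-<-trans (m/n*n≤m (x + d) (suc d)) (+-monoʳ-< x (n<1+n d))

<ceilDiv⇔ : ∀ n x d .{{_ : NonZero d}} → n < ceilDiv x d ⇔ n * d < x
<ceilDiv⇔ n x d = mk⇔ to (λ nd<x → *-cancelʳ-< d n (ceilDiv x d) (<-≤-trans nd<x (ceilDiv-*≥ x d)))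
  where
  to : n < ceilDiv x d → n * d < x
  to n<c = +-cancelʳ-< d (n * d) x (begin-strict
    n * d + d             ≡⟨ +-comm (n * d) d ⟩
    suc n * d             ≤⟨ *-monoˡ-≤ d n<c ⟩
    ceilDiv x d * d       <⟨ ceilDiv-*< x d ⟩
    x + d                 ∎)
    where open ≤-Reasoning

ceilDiv[m*n]≤m : ∀ m {n d} .{{_ : NonZero d}} → n < d → ceilDiv (m * n) d ≤ m
ceilDiv[m*n]≤m m {n} {d} n<d =
  ≮⇒≥ λ m<c → <⇒≱ (Equivalence.to (<ceilDiv⇔ m (m * n) d) m<c) (*-monoʳ-≤ m (<⇒≤ n<d))

/-complement : ∀ {d s y z} .{{_ : NonZero d}} → z + suc y ≡ d → s ≤ d → (s + z) / d ≡ 𝟙 (y <? s)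
/-complement {d} {s} {y} {z} z+1+y≡d s≤d with y <? s
... | yes y<s = /-unique d (begin
  1 * d       ≡⟨ *-identityˡ d ⟩
  d           ≡⟨ z+1+y≡d ⟨
  z + suc y   ≤⟨ +-monoʳ-≤ z y<s ⟩
  z + s       ≡⟨ +-comm z s ⟩
  s + z       ∎) (begin-strict
  s + z       <⟨ +-mono-≤-< s≤d (≤-trans (m<m+n z z<s) (≤-reflexive z+1+y≡d)) ⟩
  d + d       ≡⟨ cong (d +_) (*-identityˡ d) ⟨
  2 * d       ∎)
  where open ≤-Reasoning
... | no y≮s = m<n⇒m/n≡0 (begin-strict
  s + z       ≤⟨ +-monoˡ-≤ z (≮⇒≥ y≮s) ⟩
  y + z       <⟨ n<1+n (y + z) ⟩
  suc y + z   ≡⟨ +-comm (suc y) z ⟩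
  z + suc y   ≡⟨ z+1+y≡d ⟩
  d           ∎)
  where open ≤-Reasoning

/-ceilDiv-complement : ∀ {d r Z W X} .{{_ : NonZero d}} →
                       Z + W ≡ d → X + ceilDiv (r * W) d ≡ r → r * Z / d ≡ X
/-ceilDiv-complement {d} {r} {Z} {W} {X} Z+W≡d X+c≡r = /-unique d Xd≤rZ rZ<[1+X]d
  where
  c = ceilDiv (r * W) d
  split : X * d + c * d ≡ r * Z + r * W
  split = begin
    X * d + c * d   ≡⟨ *-distribʳ-+ d X c ⟨
    (X + c) * d     ≡⟨ cong (_* d) X+c≡r ⟩
    r * d           ≡⟨ cong (r *_) Z+W≡d ⟨
    r * (Z + W)     ≡⟨ *-distribˡ-+ r Z W ⟩
    r * Z + r * W   ∎
    where open ≡-Reasoning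
  Xd≤rZ : X * d ≤ r * Z
  Xd≤rZ = +-cancelʳ-≤ (r * W) (X * d) (r * Z) (begin
    X * d + r * W   ≤⟨ +-monoʳ-≤ (X * d) (ceilDiv-*≥ (r * W) d) ⟩
    X * d + c * d   ≡⟨ split ⟩
    r * Z + r * W   ∎)
    where open ≤-Reasoning
  rZ<[1+X]d : r * Z < suc X * d
  rZ<[1+X]d = +-cancelʳ-< (r * W) (r * Z) (suc X * d) (begin-strict
    r * Z + r * W         ≡⟨ split ⟨
    X * d + c * d         <⟨ +-monoʳ-< (X * d) (ceilDiv-*< (r * W) d) ⟩
    X * d + (r * W + d)   ≡⟨ x∙yz≈zx∙y (X * d) (r * W) d ⟩
    suc X * d + r * W     ∎)
    where open ≤-Reasoning

ceilDiv[m*n]≡ceilDiv[m*[n%d]]+m*[n/d] : ∀ m n d .{{_ : NonZero d}} →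
                                        ceilDiv (m * n) d ≡ ceilDiv (m * (n % d)) d + m * (n / d)
ceilDiv[m*n]≡ceilDiv[m*[n%d]]+m*[n/d] m n d = begin
  ceilDiv (m * n) d                            ≡⟨ cong (λ x → ceilDiv (m * x) d) (m≡m%n+[m/n]*n n d) ⟩
  ceilDiv (m * (n % d + n / d * d)) d          ≡⟨ cong (λ x → ceilDiv x d) (*-distribˡ-+ m (n % d) _) ⟩
  ceilDiv (m * (n % d) + m * (n / d * d)) d    ≡⟨ cong (λ x → ceilDiv (m * (n % d) + x) d) (*-assoc m (n / d) d) ⟨
  ceilDiv (m * (n % d) + m * (n / d) * d) d    ≡⟨ ceilDiv-+* (m * (n % d)) (m * (n / d)) d ⟩
  ceilDiv (m * (n % d)) d + m * (n / d)        ∎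
  where open ≡-Reasoning

∸suc<⇔∸≤ : ∀ {a w c} → w < a → a ∸ suc w < c ⇔ a ∸ c ≤ w
∸suc<⇔∸≤ {a} {w} {c} w<a = mk⇔ to from
  where
  open ≤-Reasoning
  to : a ∸ suc w < c → a ∸ c ≤ w
  to a∸[1+w]<c = m≤n+o⇒m∸n≤o a c (begin
    a                   ≡⟨ m∸n+n≡m w<a ⟨
    a ∸ suc w + suc w   ≡⟨ +-suc (a ∸ suc w) w ⟩
    suc (a ∸ suc w) + w ≤⟨ +-monoˡ-≤ w a∸[1+w]<c ⟩
    c + w               ∎)
  from : a ∸ c ≤ w → a ∸ suc w < c
  from a∸c≤w = +-cancelʳ-< (suc w) (a ∸ suc w) c (begin-strict
    a ∸ suc w + suc w   ≡⟨ m∸n+n≡m w<a ⟩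
    a                   ≤⟨ m≤n+m∸n a c ⟩
    c + (a ∸ c)         ≤⟨ +-monoʳ-≤ c a∸c≤w ⟩
    c + w               <⟨ +-monoʳ-< c (n<1+n w) ⟩
    c + suc w           ∎)

quotient-threshold : ∀ {a b s w} .{{_ : NonZero a}} .{{_ : NonZero b}} → w < a →
                     b * (a ∸ suc w) / a < s ⇔ a ∸ ceilDiv (a * s) b ≤ w
quotient-threshold {a} {b} {s} {w} w<a = mk⇔
  (λ lt → Equivalence.to (∸suc<⇔∸≤ w<a) (Equivalence.from (<ceilDiv⇔ Z (a * s) b)
            (subst₂ _<_ (*-comm b Z) (*-comm s a) (Equivalence.to (/-<⇔ (b * Z) s a) lt))))
  (λ le → Equivalence.from (/-<⇔ (b * Z) s a)
            (subst₂ _<_ (*-comm Z b) (*-comm a s) (Equivalence.to (<ceilDiv⇔ Z (a * s) b)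
              (Equivalence.from (∸suc<⇔∸≤ w<a) le))))
  where
  Z = a ∸ suc w

m∸n+o<m : ∀ {m n o} → n ≤ m → o < n → m ∸ n + o < m
m∸n+o<m {m} {n} {o} n≤m o<n = subst (m ∸ n + o <_) (m∸n+n≡m n≤m) (+-monoʳ-< (m ∸ n) o<n)

m≤m∸n+o+n : ∀ {m n} o → n ≤ m → m ≤ m ∸ n + o + n
m≤m∸n+o+n {m} {n} o n≤m = subst (_≤ m ∸ n + o + n) (m∸n+n≡m n≤m) (+-monoˡ-≤ n (m≤m+n (m ∸ n) o))

module Setup
  {a b : ℕ} .{{_ : NonZero a}} .{{_ : NonZero b}} (a<b : a < b)
  {r : ℕ} (r≡b%a : r ≡ b % a) .{{_ : NonZero r}}
  {R : Fin r → Fin r} (R-perm : IsPermutation r R)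
  {A : Fin a → Fin a} (A-ext : IsExtensionSeq r (asℕ R) a A)
  {A' : Fin a → Fin a} (A'-ext : IsExtensionSeq r (complement r R) a A')
  {B : Fin b → Fin b} (B-ext : IsExtensionSeq a (asℕ A') b B)
  (hyp : ∀ k → ceilDiv (r * k) a ≡ sumFrom (a ∸ r) r (λ i → (k + at (asℕ A) i) / a))
  where

  R̂ Â Â' B̂ : ℕ → ℕ
  R̂  = at (asℕ R)
  Â  = at (asℕ A)
  Â' = at (asℕ A')
  B̂  = at (asℕ B)

  r<a : r < a
  r<a = subst (_< a) (sym r≡b%a) (m%n<n b a)

  b≡[b/a]*a+r : b ≡ b / a * a + r
  b≡[b/a]*a+r = trans (m≡m%n+[m/n]*n b a) (trans (+-comm (b % a) _) (cong (b / a * a +_) (sym r≡b%a)))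

  countAbove : ℕ → ℕ
  countAbove t = ∑< a (λ j → 𝟙 (t <? R̂ (j % r)))

  A-last : ∀ {u} → u < r → Â (a ∸ r + u) + suc (countAbove (R̂ ((a ∸ r + u) % r))) ≡ a
  A-last {u} u<r = ext-rank-last (asℕ-injective R-perm) A-ext (m∸n+o<m (<⇒≤ r<a) u<r) (m≤m∸n+o+n u (<⇒≤ r<a))

  A'-first : ∀ {ρ} → ρ < r → Â' ρ ≡ countAbove (R̂ ρ)
  A'-first ρ<r = trans (ext-rank-first (complement-injective R-perm) A'-ext (<-trans ρ<r r<a) ρ<r)
                       (∑<-cong a λ {j} _ → 𝟙-cong _ _ (at-complement-<⇔ (m%n<n j r) ρ<r))

  count-below : ∀ {w} → w < a → ∑< r (λ t → 𝟙 (countAbove t <? suc w)) ≡ ceilDiv (r * suc w) a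
  count-below {w} w<a = begin
    ∑< r (λ t → 𝟙 (countAbove t <? suc w))                         ≡⟨ ∑<-rotate-permute R-perm _ (a ∸ r) ⟨
    ∑< r (λ u → 𝟙 (countAbove (R̂ ((a ∸ r + u) % r)) <? suc w))     ≡⟨ ∑<-cong r (λ u<r → /-complement (A-last u<r) w<a) ⟨
    ∑< r (λ u → (suc w + Â (a ∸ r + u)) / a)                        ≡⟨ sumFrom≡∑< (a ∸ r) r _ ⟨
    sumFrom (a ∸ r) r (λ i → (suc w + Â i) / a)                     ≡⟨ hyp (suc w) ⟨
    ceilDiv (r * suc w) a                                           ∎
    where open ≡-Reasoning

  count-above : ∀ {w} → w < a → ∑< r (λ t → 𝟙 (w <? countAbove t)) ≡ r * (a ∸ suc w) / a
  count-above {w} w<a = sym (/-ceilDiv-complement (m∸n+n≡m w<a)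
    (trans (cong (∑< r (λ t → 𝟙 (w <? countAbove t)) +_) (sym (count-below w<a)))
           (count-≤+< r countAbove (suc w))))

  A'-count-above : ∀ {w} → w < a → ∑< b (λ j → 𝟙 (w <? Â' (j % a))) ≡ b * (a ∸ suc w) / a
  A'-count-above {w} w<a = begin
    ∑< b (λ j → g (j % a))                                      ≡⟨ cong (λ n → ∑< n (λ j → g (j % a))) b≡[b/a]*a+r ⟩
    ∑< (q * a + r) (λ j → g (j % a))                            ≡⟨ ∑<-++ (q * a) r _ ⟩
    ∑< (q * a) (λ j → g (j % a)) + ∑< r (λ i → g ((q * a + i) % a))
      ≡⟨ cong₂ _+_ (∑<-periodic q a g) (∑<-cong r tail) ⟩
    q * ∑< a g + ∑< r (λ ρ → 𝟙 (w <? countAbove (R̂ ρ)))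
      ≡⟨ cong₂ _+_ (cong (q *_) (count≥-permute (proj₁ A'-ext) w<a)) (∑<-permute R-perm (λ t → 𝟙 (w <? countAbove t))) ⟩
    q * Z + ∑< r (λ t → 𝟙 (w <? countAbove t))                   ≡⟨ cong (q * Z +_) (count-above w<a) ⟩
    q * Z + r * Z / a                                           ≡⟨ +-comm (q * Z) _ ⟩
    r * Z / a + q * Z                                           ≡⟨ [m+kn]/n≡m/n+k (r * Z) (q * Z) a ⟨
    (r * Z + q * Z * a) / a                                     ≡⟨ cong (_/ a) regroup ⟩
    b * Z / a                                                   ∎
    where
    open ≡-Reasoning
    q = b / a
    Z = a ∸ suc w
    g : ℕ → ℕ
    g ρ = 𝟙 (w <? Â' ρ)
    tail : ∀ {i} → i < r → g ((q * a + i) % a) ≡ 𝟙 (w <? countAbove (R̂ i))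
    tail {i} i<r = begin
      g ((q * a + i) % a)   ≡⟨ cong (λ x → g (x % a)) (+-comm (q * a) i) ⟩
      g ((i + q * a) % a)   ≡⟨ cong g ([m+kn]%n≡m%n i q a) ⟩
      g (i % a)             ≡⟨ cong g (m<n⇒m%n≡m (<-trans i<r r<a)) ⟩
      g i                   ≡⟨ cong (λ x → 𝟙 (w <? x)) (A'-first i<r) ⟩
      𝟙 (w <? countAbove (R̂ i)) ∎
    regroup : r * Z + q * Z * a ≡ b * Z
    regroup = begin
      r * Z + q * Z * a     ≡⟨ cong (r * Z +_) (*-assoc q Z a) ⟩
      r * Z + q * (Z * a)   ≡⟨ cong (λ x → r * Z + q * x) (*-comm Z a) ⟩
      r * Z + q * (a * Z)   ≡⟨ cong (r * Z +_) (*-assoc q a Z) ⟨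
      r * Z + q * a * Z     ≡⟨ +-comm (r * Z) _ ⟩
      q * a * Z + r * Z     ≡⟨ *-distribʳ-+ Z (q * a) r ⟨
      (q * a + r) * Z       ≡⟨ cong (_* Z) b≡[b/a]*a+r ⟨
      b * Z                 ∎

  B-last : ∀ {u} → u < a → B̂ (b ∸ a + u) + suc (b * (a ∸ suc (Â' ((b ∸ a + u) % a))) / a) ≡ b
  B-last {u} u<a = trans
    (cong (λ y → B̂ (b ∸ a + u) + suc y) (sym (A'-count-above (at-asℕ< A' (m%n<n (b ∸ a + u) a)))))
    (ext-rank-last (asℕ-injective (proj₁ A'-ext)) B-ext (m∸n+o<m (<⇒≤ a<b) u<a) (m≤m∸n+o+n u (<⇒≤ a<b)))

  B-last-quotient : ∀ k {u} → u < a →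
    (k + B̂ (b ∸ a + u)) / b ≡ 𝟙 (a ∸ ceilDiv (a * (k % b)) b ≤? Â' ((b ∸ a + u) % a)) + k / b
  B-last-quotient k {u} u<a = begin
    (k + B̂ (b ∸ a + u)) / b                              ≡⟨ [m+n]/d≡[m%d+n]/d+m/d k _ b ⟩
    (k % b + B̂ (b ∸ a + u)) / b + k / b                  ≡⟨ cong (_+ k / b) (/-complement (B-last u<a) (<⇒≤ (m%n<n k b))) ⟩
    𝟙 (b * (a ∸ suc w) / a <? k % b) + k / b             ≡⟨ cong (_+ k / b) (𝟙-cong _ _ (quotient-threshold w<a)) ⟩
    𝟙 (a ∸ ceilDiv (a * (k % b)) b ≤? w) + k / b         ∎
    where
    open ≡-Reasoning
    w = Â' ((b ∸ a + u) % a)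
    w<a : w < a
    w<a = at-asℕ< A' (m%n<n (b ∸ a + u) a)

proposition2p7 : (a b : ℕ) → .{{_ : NonZero a}} → .{{_ : NonZero b}} → a < b →
    (r : ℕ) → r ≡ b % a → .{{_ : NonZero r}} →
    (R : Fin r → Fin r) → IsPermutation r R →
    (A : Fin a → Fin a) → IsExtensionSeq r (asℕ R) a A →
    (A' : Fin a → Fin a) → IsExtensionSeq r (complement r R) a A' →
    (B : Fin b → Fin b) → IsExtensionSeq a (asℕ A') b B →
    (∀ (k : ℕ) → ceilDiv (r * k) a ≡ sumFrom (a ∸ r) r (λ i → (k + at (asℕ A) i) / a)) →
    ∀ (k : ℕ) → ceilDiv (a * k) b ≡ sumFrom (b ∸ a) a (λ i → (k + at (asℕ B) i) / b)
proposition2p7 a b a<b r r≡b%a R R-perm A A-ext A' A'-ext B B-ext hyp k = begin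
  ceilDiv (a * k) b                                          ≡⟨ ceilDiv[m*n]≡ceilDiv[m*[n%d]]+m*[n/d] a k b ⟩
  C + a * (k / b)                                            ≡⟨ cong₂ _+_ (count-threshold (ceilDiv[m*n]≤m a (m%n<n k b)))
                                                                         (∑<-const a (k / b)) ⟨
  ∑< a (λ w → 𝟙 (a ∸ C ≤? w)) + ∑< a (λ _ → k / b)           ≡⟨ ∑<-distrib-+ a _ _ ⟨
  ∑< a (λ w → 𝟙 (a ∸ C ≤? w) + k / b)                        ≡⟨ ∑<-rotate-permute (proj₁ A'-ext) _ (b ∸ a) ⟨
  ∑< a (λ u → 𝟙 (a ∸ C ≤? Â' ((b ∸ a + u) % a)) + k / b)     ≡⟨ ∑<-cong a (B-last-quotient k) ⟨
  ∑< a (λ u → (k + B̂ (b ∸ a + u)) / b)                       ≡⟨ sumFrom≡∑< (b ∸ a) a _ ⟨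
  sumFrom (b ∸ a) a (λ i → (k + B̂ i) / b)                    ∎
  where
  open ≡-Reasoning
  open Setup a<b r≡b%a R-perm A-ext A'-ext B-ext hyp
  C = ceilDiv (a * (k % b)) b
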